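{- In the Calculus of Algebraic Constructions with Size Annotations, if $\Gamma\vdash t:T$ then for every size substitution $\psi$, $\Gamma\psi\vdash t\psi:T\psi$.
   Context: Sorts $\mathcal S=\{\star,\Box\}$; variables $\mathcal X$, each $x$ with a sort $s_x$; symbols $\mathcal F$, each $f$ with a sort $s_f$ and a closed type $\tau_f$, where $\tau_f$ contains no size variables if $s_f=\Box$. A set $\mathcal R$ of rewrite rules, containing no size variables, is given; $\mathcal{CF}^\Box$ denotes the symbols of sort $\Box$ heading no rule left-hand side. Size expressions form a first-order term algebra $\mathcal A$ over size symbols and size variables with a quasi-ordering $\le_{\mathcal A}$ stable under size substitution. Terms: $t::= s\mid x\mid C^a\mid f\mid [x:t]t\mid (x:t)t\mid tt$ ($C\in\mathcal{CF}^\Box$, $a\in\mathcal A$, $f\notin\mathcal{CF}^\Box$); size substitutions act on size annotations. Reduction $\to=\beta\cup\mathcal R$ is assumed confluent; $T\downarrow U$ means common reduct. Subtyping $\le$: smallest relation closed under $T\le T$; $C^a\vec t\le C^b\vec t$ if $a\le_{\mathcal A}b$; $(x:U)V\le(x:U')V'$ if $U'\le U$, $V\le V'$; $T\le U$ if $T\downarrow T'$, $T'\le U'$, $U'\downarrow U$; transitivity. Typing rules: $\vdash\star:\Box$; if $\vdash\tau_C:\Box$ then $\vdash C^a:\tau_C$ ($C\in\mathcal{CF}^\Box$); if $\vdash\tau_f:s_f$ then $\vdash f:\tau_f\varphi$ for any size substitution $\varphi$ ($f\notin\mathcal{CF}^\Box$); if $\Gamma\vdash T:s_x$ then $\Gamma,x:T\vdash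 x:T$ ($x\notin\mathrm{dom}\Gamma$); if $\Gamma\vdash t:T$ and $\Gamma\vdash U:s_x$ then $\Gamma,x:U\vdash t:T$ ($x\notin\mathrm{dom}\Gamma$); if $\Gamma\vdash U:s$ and $\Gamma,x:U\vdash V:s'$ then $\Gamma\vdash(x:U)V:s'$; if $\Gamma,x:U\vdash v:V$ and $\Gamma\vdash(x:U)V:s$ then $\Gamma\vdash[x:U]v:(x:U)V$; if $\Gamma\vdash t:(x:U)V$ and $\Gamma\vdash u:U$ then $\Gamma\vdash tu:V\{x\mapsto u\}$; if $\Gamma\vdash t:T$, $\Gamma\vdash T':s$ and $T\le T'$ then $\Gamma\vdash t:T'$. Standing assumptions: $\vdash\tau_f:s_f$ for all $f$, $\beta\cup\mathcal R$ is confluent, and rules preserve typing (if $l\to r\in\mathcal R$ and $\Gamma\vdash l\sigma:T$ then $\Gamma\vdash r\sigma:T$). -}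

module Defs where

open import Data.Nat using (ℕ; zero; suc; _<_)
open import Data.Vec using (Vec; []; _∷_)
open import Data.List using (List; []; _∷_)
open import Data.Maybe using (Maybe; just; nothing)
open import Data.Product using (_×_; _,_; ∃)
open import Data.Empty using (⊥)
open import Data.Unit using (⊤)
open import Relation.Nullary using (¬_)
open import Relation.Binary.PropositionalEquality using (_≡_; _≢_)
open import Relation.Binary.Construct.Closure.ReflexiveTransitive using (Star)

data Sort : Set where
  ⋆ □ : Sort

module Sizes (SSym : Set) (ar : SSym → ℕ) where

  data Size : Set where
    svar : ℕ → Size
    sapp : (g : SSym) → Vec Size (ar g) → Size

  SizeSubst : Set
  SizeSubst = ℕ → Size

  mutual
    _⟪_⟫ : Size → SizeSubst → Size
    svar i ⟪ φ ⟫ = φ i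
    sapp g as ⟪ φ ⟫ = sapp g (substVec as φ)

    substVec : ∀ {n} → Vec Size n → SizeSubst → Vec Size n
    substVec [] φ = []
    substVec (a ∷ as) φ = (a ⟪ φ ⟫) ∷ substVec as φ

  mutual
    GroundSize : Size → Set
    GroundSize (svar _) = ⊥
    GroundSize (sapp g as) = GroundVec as

    GroundVec : ∀ {n} → Vec Size n → Set
    GroundVec [] = ⊤
    GroundVec (a ∷ as) = GroundSize a × GroundVec as

-- Terms (de Bruijn indices; binders and context entries carry the
-- sort s_x of the bound variable).

module Syntax (SSym : Set) (ar : SSym → ℕ) (Sym : Set) where

  open Sizes SSym ar public

  data Term : Set where
    sort : Sort → Term
    var  : ℕ → Term
    csym : Sym → Size → Term              -- C^a   (C ∈ CF^□)
    fsym : Sym → Term                     -- f     (f ∉ CF^□)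
    lam  : Sort → Term → Term → Term
    pi   : Sort → Term → Term → Term
    app  : Term → Term → Term

  apps : Term → List Term → Term
  apps t [] = t
  apps t (u ∷ us) = apps (app t u) us

  extR : (ℕ → ℕ) → ℕ → ℕ
  extR ρ zero = zero
  extR ρ (suc i) = suc (ρ i)

  rename : (ℕ → ℕ) → Term → Term
  rename ρ (sort s) = sort s
  rename ρ (var i) = var (ρ i)
  rename ρ (csym C a) = csym C a
  rename ρ (fsym f) = fsym f
  rename ρ (lam s U v) = lam s (rename ρ U) (rename (extR ρ) v)
  rename ρ (pi s U V) = pi s (rename ρ U) (rename (extR ρ) V)
  rename ρ (app t u) = app (rename ρ t) (rename ρ u)

  weaken : Term → Term
  weaken = rename suc

  extS : (ℕ → Term) → ℕ → Term
  extS σ zero = var zero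
  extS σ (suc i) = weaken (σ i)

  subst : (ℕ → Term) → Term → Term
  subst σ (sort s) = sort s
  subst σ (var i) = σ i
  subst σ (csym C a) = csym C a
  subst σ (fsym f) = fsym f
  subst σ (lam s U v) = lam s (subst σ U) (subst (extS σ) v)
  subst σ (pi s U V) = pi s (subst σ U) (subst (extS σ) V)
  subst σ (app t u) = app (subst σ t) (subst σ u)

  -- single substitution  V{x ↦ u}  (x = the outermost bound index 0)
  single : Term → ℕ → Term
  single u zero = u
  single u (suc i) = var i

  _[_] : Term → Term → Term
  V [ u ] = subst (single u) V

  _⟦_⟧ : Term → SizeSubst → Term
  sort s ⟦ ψ ⟧ = sort s
  var i ⟦ ψ ⟧ = var i
  csym C a ⟦ ψ ⟧ = csym C (a ⟪ ψ ⟫)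
  fsym f ⟦ ψ ⟧ = fsym f
  lam s U v ⟦ ψ ⟧ = lam s (U ⟦ ψ ⟧) (v ⟦ ψ ⟧)
  pi s U V ⟦ ψ ⟧ = pi s (U ⟦ ψ ⟧) (V ⟦ ψ ⟧)
  app t u ⟦ ψ ⟧ = app (t ⟦ ψ ⟧) (u ⟦ ψ ⟧)

  -- typing contexts: innermost variable first; each entry (s_x , T)
  Ctx : Set
  Ctx = List (Sort × Term)

  _⟦_⟧ᶜ : Ctx → SizeSubst → Ctx
  [] ⟦ ψ ⟧ᶜ = []
  ((s , T) ∷ Γ) ⟦ ψ ⟧ᶜ = (s , T ⟦ ψ ⟧) ∷ (Γ ⟦ ψ ⟧ᶜ)

  NoSizeVar : Term → Set
  NoSizeVar (sort s) = ⊤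
  NoSizeVar (var i) = ⊤
  NoSizeVar (csym C a) = GroundSize a
  NoSizeVar (fsym f) = ⊤
  NoSizeVar (lam s U v) = NoSizeVar U × NoSizeVar v
  NoSizeVar (pi s U V) = NoSizeVar U × NoSizeVar V
  NoSizeVar (app t u) = NoSizeVar t × NoSizeVar u

  ScopedIn : ℕ → Term → Set
  ScopedIn n (sort s) = ⊤
  ScopedIn n (var i) = i < n
  ScopedIn n (csym C a) = ⊤
  ScopedIn n (fsym f) = ⊤
  ScopedIn n (lam s U v) = ScopedIn n U × ScopedIn (suc n) v
  ScopedIn n (pi s U V) = ScopedIn n U × ScopedIn (suc n) V
  ScopedIn n (app t u) = ScopedIn n t × ScopedIn n u

  Closed : Term → Set
  Closed = ScopedIn zero

  headSym : Term → Maybe Sym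
  headSym (csym C a) = just C
  headSym (fsym f) = just f
  headSym (app t u) = headSym t
  headSym _ = nothing

-- The calculus, parameterised by
--   SSym, ar   : size symbols with arities
--   Sym        : the symbols F
--   _≤A_       : the quasi-ordering on size expressions
--   sortOf     : f ↦ s_f
--   typeOf     : f ↦ τ_f
--   Rule       : the set R of rewrite rules (l → r ∈ R  iff  Rule l r)

module CAC (SSym : Set) (ar : SSym → ℕ) (Sym : Set)
           (_≤A_ : Sizes.Size SSym ar → Sizes.Size SSym ar → Set)
           (sortOf : Sym → Sort)
           (typeOf : Sym → Syntax.Term SSym ar Sym)
           (Rule : Syntax.Term SSym ar Sym → Syntax.Term SSym ar Sym → Set)
           where

  open Syntax SSym ar Sym public

  CF : Sym → Set
  CF C = (sortOf C ≡ □) × (∀ l r → Rule l r → headSym l ≢ just C)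

  infix 4 _⟶_
  data _⟶_ : Term → Term → Set where
    beta  : ∀ {s U v u} → app (lam s U v) u ⟶ v [ u ]
    rule  : ∀ {l r} (σ : ℕ → Term) → Rule l r → subst σ l ⟶ subst σ r
    appL  : ∀ {t t' u} → t ⟶ t' → app t u ⟶ app t' u
    appR  : ∀ {t u u'} → u ⟶ u' → app t u ⟶ app t u'
    lamL  : ∀ {s U U' v} → U ⟶ U' → lam s U v ⟶ lam s U' v
    lamR  : ∀ {s U v v'} → v ⟶ v' → lam s U v ⟶ lam s U v'
    piL   : ∀ {s U U' V} → U ⟶ U' → pi s U V ⟶ pi s U' V
    piR   : ∀ {s U V V'} → V ⟶ V' → pi s U V ⟶ pi s U V'

  infix 4 _⟶*_ _↓_
  _⟶*_ : Term → Term → Set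
  _⟶*_ = Star _⟶_

  _↓_ : Term → Term → Set
  T ↓ U = ∃ λ W → (T ⟶* W) × (U ⟶* W)

  infix 4 _≤_
  data _≤_ : Term → Term → Set where
    ≤-refl  : ∀ {T} → T ≤ T
    ≤-size  : ∀ {C a b} (ts : List Term) → a ≤A b →
              apps (csym C a) ts ≤ apps (csym C b) ts
    ≤-prod  : ∀ {s U U' V V'} → U' ≤ U → V ≤ V' → pi s U V ≤ pi s U' V'
    ≤-conv  : ∀ {T T' U U'} → T ↓ T' → T' ≤ U' → U' ↓ U → T ≤ U
    ≤-trans : ∀ {T U V} → T ≤ U → U ≤ V → T ≤ V

  infix 4 _⊢_∶_
  data _⊢_∶_ : Ctx → Term → Term → Set where
    ax    : [] ⊢ sort ⋆ ∶ sort □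
    size  : ∀ {C a} → CF C → [] ⊢ typeOf C ∶ sort □ →
            [] ⊢ csym C a ∶ typeOf C
    symb  : ∀ {f} → ¬ CF f → [] ⊢ typeOf f ∶ sort (sortOf f) →
            (φ : SizeSubst) → [] ⊢ fsym f ∶ typeOf f ⟦ φ ⟧
    varI  : ∀ {Γ T s} → Γ ⊢ T ∶ sort s →
            ((s , T) ∷ Γ) ⊢ var zero ∶ weaken T
    weak  : ∀ {Γ t T U s} → Γ ⊢ t ∶ T → Γ ⊢ U ∶ sort s →
            ((s , U) ∷ Γ) ⊢ weaken t ∶ weaken T
    prod  : ∀ {Γ sx U V s s'} → Γ ⊢ U ∶ sort s → ((sx , U) ∷ Γ) ⊢ V ∶ sort s' →
            Γ ⊢ pi sx U V ∶ sort s'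
    abs   : ∀ {Γ sx U v V s} → ((sx , U) ∷ Γ) ⊢ v ∶ V → Γ ⊢ pi sx U V ∶ sort s →
            Γ ⊢ lam sx U v ∶ pi sx U V
    appI  : ∀ {Γ t u sx U V} → Γ ⊢ t ∶ pi sx U V → Γ ⊢ u ∶ U →
            Γ ⊢ app t u ∶ V [ u ]
    sub   : ∀ {Γ t T T' s} → Γ ⊢ t ∶ T → Γ ⊢ T' ∶ sort s → T ≤ T' →
            Γ ⊢ t ∶ T'

  SizeOrderAssumption : Set
  SizeOrderAssumption =
    (∀ a → a ≤A a) × (∀ {a b c} → a ≤A b → b ≤A c → a ≤A c) ×
    (∀ {a b} (φ : SizeSubst) → a ≤A b → (a ⟪ φ ⟫) ≤A (b ⟪ φ ⟫))

  SymbolTypeAssumption : Set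
  SymbolTypeAssumption =
    (∀ f → Closed (typeOf f)) × (∀ f → sortOf f ≡ □ → NoSizeVar (typeOf f))

  RuleAssumption : Set
  RuleAssumption = ∀ l r → Rule l r → NoSizeVar l × NoSizeVar r

  WellTypedSymbols : Set
  WellTypedSymbols = ∀ f → [] ⊢ typeOf f ∶ sort (sortOf f)

  Confluent : Set
  Confluent = ∀ {t u v} → t ⟶* u → t ⟶* v → u ↓ v

  RulesPreserveTyping : Set
  RulesPreserveTyping =
    ∀ {l r} (σ : ℕ → Term) {Γ T} → Rule l r → Γ ⊢ subst σ l ∶ T → Γ ⊢ subst σ r ∶ T

-- A size substitution ψ only touches size annotations, so it commutes with
-- renaming and term substitution; hence it maps β-steps to β-steps, and maps
-- rule steps to rule steps because rules contain no size variables. Size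
-- subtyping is preserved because ≤A is stable under size substitution. The
-- typing rules are then preserved one by one: the type of a symbol C^a of
-- CF^□ has no size variables and so is fixed by ψ, and an instance τ_f φ of
-- a symbol type becomes the instance τ_f (φ ⨾ ψ).
module Submission where

open import Data.Nat using (ℕ; zero; suc)
open import Data.Vec using (Vec; []; _∷_)
open import Data.List using ([]; _∷_; map)
open import Data.Product using (_,_; proj₁; proj₂)
open import Relation.Binary.PropositionalEquality as ≡
  using (_≡_; refl; sym; trans; cong; cong₂; subst₂)
open import Relation.Binary.Construct.Closure.ReflexiveTransitive using (gmap)
open import Defs

module _ {SSym : Set} {ar : SSym → ℕ} where

  open Sizes SSym ar

  infixl 5 _⨾_
  _⨾_ : SizeSubst → SizeSubst → SizeSubst
  (φ ⨾ ψ) i = φ i ⟪ ψ ⟫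

  mutual
    ⟪⟫-⨾ : ∀ a φ ψ → a ⟪ φ ⟫ ⟪ ψ ⟫ ≡ a ⟪ φ ⨾ ψ ⟫
    ⟪⟫-⨾ (svar i) φ ψ = refl
    ⟪⟫-⨾ (sapp g as) φ ψ = cong (sapp g) (substVec-⨾ as φ ψ)

    substVec-⨾ : ∀ {n} (as : Vec Size n) φ ψ →
                 substVec (substVec as φ) ψ ≡ substVec as (φ ⨾ ψ)
    substVec-⨾ [] φ ψ = refl
    substVec-⨾ (a ∷ as) φ ψ = cong₂ _∷_ (⟪⟫-⨾ a φ ψ) (substVec-⨾ as φ ψ)

  mutual
    ⟪⟫-ground : ∀ a ψ → GroundSize a → a ⟪ ψ ⟫ ≡ a
    ⟪⟫-ground (svar i) ψ ()
    ⟪⟫-ground (sapp g as) ψ ground = cong (sapp g) (substVec-ground as ψ ground)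

    substVec-ground : ∀ {n} (as : Vec Size n) ψ → GroundVec as → substVec as ψ ≡ as
    substVec-ground [] ψ _ = refl
    substVec-ground (a ∷ as) ψ (ground , grounds) =
      cong₂ _∷_ (⟪⟫-ground a ψ ground) (substVec-ground as ψ grounds)

module _ {SSym : Set} {ar : SSym → ℕ} {Sym : Set} where

  open Syntax SSym ar Sym

  ⟦⟧-⨾ : ∀ T φ ψ → T ⟦ φ ⟧ ⟦ ψ ⟧ ≡ T ⟦ φ ⨾ ψ ⟧
  ⟦⟧-⨾ (sort s) φ ψ = refl
  ⟦⟧-⨾ (var i) φ ψ = refl
  ⟦⟧-⨾ (csym C a) φ ψ = cong (csym C) (⟪⟫-⨾ a φ ψ)
  ⟦⟧-⨾ (fsym f) φ ψ = refl
  ⟦⟧-⨾ (lam s U v) φ ψ = cong₂ (lam s) (⟦⟧-⨾ U φ ψ) (⟦⟧-⨾ v φ ψ)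
  ⟦⟧-⨾ (pi s U V) φ ψ = cong₂ (pi s) (⟦⟧-⨾ U φ ψ) (⟦⟧-⨾ V φ ψ)
  ⟦⟧-⨾ (app t u) φ ψ = cong₂ app (⟦⟧-⨾ t φ ψ) (⟦⟧-⨾ u φ ψ)

  ⟦⟧-noSizeVar : ∀ T ψ → NoSizeVar T → T ⟦ ψ ⟧ ≡ T
  ⟦⟧-noSizeVar (sort s) ψ _ = refl
  ⟦⟧-noSizeVar (var i) ψ _ = refl
  ⟦⟧-noSizeVar (csym C a) ψ ground = cong (csym C) (⟪⟫-ground a ψ ground)
  ⟦⟧-noSizeVar (fsym f) ψ _ = refl
  ⟦⟧-noSizeVar (lam s U v) ψ (nU , nv) =
    cong₂ (lam s) (⟦⟧-noSizeVar U ψ nU) (⟦⟧-noSizeVar v ψ nv)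
  ⟦⟧-noSizeVar (pi s U V) ψ (nU , nV) =
    cong₂ (pi s) (⟦⟧-noSizeVar U ψ nU) (⟦⟧-noSizeVar V ψ nV)
  ⟦⟧-noSizeVar (app t u) ψ (nt , nu) =
    cong₂ app (⟦⟧-noSizeVar t ψ nt) (⟦⟧-noSizeVar u ψ nu)

  rename-⟦⟧ : ∀ ρ T ψ → rename ρ T ⟦ ψ ⟧ ≡ rename ρ (T ⟦ ψ ⟧)
  rename-⟦⟧ ρ (sort s) ψ = refl
  rename-⟦⟧ ρ (var i) ψ = refl
  rename-⟦⟧ ρ (csym C a) ψ = refl
  rename-⟦⟧ ρ (fsym f) ψ = refl
  rename-⟦⟧ ρ (lam s U v) ψ = cong₂ (lam s) (rename-⟦⟧ ρ U ψ) (rename-⟦⟧ (extR ρ) v ψ)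
  rename-⟦⟧ ρ (pi s U V) ψ = cong₂ (pi s) (rename-⟦⟧ ρ U ψ) (rename-⟦⟧ (extR ρ) V ψ)
  rename-⟦⟧ ρ (app t u) ψ = cong₂ app (rename-⟦⟧ ρ t ψ) (rename-⟦⟧ ρ u ψ)

  extS-⟦⟧ : ∀ {σ σ'} ψ → (∀ i → σ i ⟦ ψ ⟧ ≡ σ' i) → ∀ i → extS σ i ⟦ ψ ⟧ ≡ extS σ' i
  extS-⟦⟧ ψ eq zero = refl
  extS-⟦⟧ {σ} ψ eq (suc i) = trans (rename-⟦⟧ suc (σ i) ψ) (cong weaken (eq i))

  subst-⟦⟧ : ∀ {σ σ'} ψ → (∀ i → σ i ⟦ ψ ⟧ ≡ σ' i) →
             ∀ T → subst σ T ⟦ ψ ⟧ ≡ subst σ' (T ⟦ ψ ⟧)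
  subst-⟦⟧ ψ eq (sort s) = refl
  subst-⟦⟧ ψ eq (var i) = eq i
  subst-⟦⟧ ψ eq (csym C a) = refl
  subst-⟦⟧ ψ eq (fsym f) = refl
  subst-⟦⟧ ψ eq (lam s U v) =
    cong₂ (lam s) (subst-⟦⟧ ψ eq U) (subst-⟦⟧ ψ (extS-⟦⟧ ψ eq) v)
  subst-⟦⟧ ψ eq (pi s U V) =
    cong₂ (pi s) (subst-⟦⟧ ψ eq U) (subst-⟦⟧ ψ (extS-⟦⟧ ψ eq) V)
  subst-⟦⟧ ψ eq (app t u) = cong₂ app (subst-⟦⟧ ψ eq t) (subst-⟦⟧ ψ eq u)

  subst-⟦⟧-noSizeVar : ∀ σ ψ T → NoSizeVar T →
                       subst σ T ⟦ ψ ⟧ ≡ subst (λ i → σ i ⟦ ψ ⟧) T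
  subst-⟦⟧-noSizeVar σ ψ T noSizeVar =
    trans (subst-⟦⟧ ψ (λ _ → refl) T) (cong (subst _) (⟦⟧-noSizeVar T ψ noSizeVar))

  []-⟦⟧ : ∀ V u ψ → V [ u ] ⟦ ψ ⟧ ≡ V ⟦ ψ ⟧ [ u ⟦ ψ ⟧ ]
  []-⟦⟧ V u ψ = subst-⟦⟧ ψ single-⟦⟧ V
    where
      single-⟦⟧ : ∀ i → single u i ⟦ ψ ⟧ ≡ single (u ⟦ ψ ⟧) i
      single-⟦⟧ zero = refl
      single-⟦⟧ (suc i) = refl

  apps-⟦⟧ : ∀ t ts ψ → apps t ts ⟦ ψ ⟧ ≡ apps (t ⟦ ψ ⟧) (map (_⟦ ψ ⟧) ts)
  apps-⟦⟧ t [] ψ = refl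
  apps-⟦⟧ t (u ∷ us) ψ = apps-⟦⟧ (app t u) us ψ

module SizeSubstitutionStability
    (SSym : Set) (ar : SSym → ℕ) (Sym : Set)
    (_≤A_ : Sizes.Size SSym ar → Sizes.Size SSym ar → Set)
    (sortOf : Sym → Sort)
    (typeOf : Sym → Syntax.Term SSym ar Sym)
    (Rule : Syntax.Term SSym ar Sym → Syntax.Term SSym ar Sym → Set) where

  open CAC SSym ar Sym _≤A_ sortOf typeOf Rule

  module _ (rulesNoSizeVar : RuleAssumption) where

    ⟶-⟦⟧ : ∀ ψ {T U} → T ⟶ U → T ⟦ ψ ⟧ ⟶ U ⟦ ψ ⟧
    ⟶-⟦⟧ ψ (beta {s} {U} {v} {u}) =
      ≡.subst (app (lam s (U ⟦ ψ ⟧) (v ⟦ ψ ⟧)) (u ⟦ ψ ⟧) ⟶_) (sym ([]-⟦⟧ v u ψ)) beta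
    ⟶-⟦⟧ ψ (rule {l} {r} σ l→r) =
      subst₂ _⟶_ (sym (subst-⟦⟧-noSizeVar σ ψ l noSizeVarˡ))
                 (sym (subst-⟦⟧-noSizeVar σ ψ r noSizeVarʳ))
                 (rule (λ i → σ i ⟦ ψ ⟧) l→r)
      where
        noSizeVarˡ = proj₁ (rulesNoSizeVar l r l→r)
        noSizeVarʳ = proj₂ (rulesNoSizeVar l r l→r)
    ⟶-⟦⟧ ψ (appL step) = appL (⟶-⟦⟧ ψ step)
    ⟶-⟦⟧ ψ (appR step) = appR (⟶-⟦⟧ ψ step)
    ⟶-⟦⟧ ψ (lamL step) = lamL (⟶-⟦⟧ ψ step)
    ⟶-⟦⟧ ψ (lamR step) = lamR (⟶-⟦⟧ ψ step)
    ⟶-⟦⟧ ψ (piL step) = piL (⟶-⟦⟧ ψ step)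
    ⟶-⟦⟧ ψ (piR step) = piR (⟶-⟦⟧ ψ step)

    ↓-⟦⟧ : ∀ ψ {T U} → T ↓ U → T ⟦ ψ ⟧ ↓ U ⟦ ψ ⟧
    ↓-⟦⟧ ψ (W , T⟶*W , U⟶*W) =
      W ⟦ ψ ⟧ , gmap (_⟦ ψ ⟧) (⟶-⟦⟧ ψ) T⟶*W , gmap (_⟦ ψ ⟧) (⟶-⟦⟧ ψ) U⟶*W

    module _ (≤A-⟪⟫ : ∀ {a b} φ → a ≤A b → (a ⟪ φ ⟫) ≤A (b ⟪ φ ⟫)) where

      ≤-⟦⟧ : ∀ ψ {T U} → T ≤ U → T ⟦ ψ ⟧ ≤ U ⟦ ψ ⟧
      ≤-⟦⟧ ψ ≤-refl = ≤-refl
      ≤-⟦⟧ ψ (≤-size {C} {a} {b} ts a≤b) =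
        subst₂ _≤_ (sym (apps-⟦⟧ (csym C a) ts ψ)) (sym (apps-⟦⟧ (csym C b) ts ψ))
               (≤-size (map (_⟦ ψ ⟧) ts) (≤A-⟪⟫ ψ a≤b))
      ≤-⟦⟧ ψ (≤-prod U'≤U V≤V') = ≤-prod (≤-⟦⟧ ψ U'≤U) (≤-⟦⟧ ψ V≤V')
      ≤-⟦⟧ ψ (≤-conv T↓T' T'≤U' U'↓U) = ≤-conv (↓-⟦⟧ ψ T↓T') (≤-⟦⟧ ψ T'≤U') (↓-⟦⟧ ψ U'↓U)
      ≤-⟦⟧ ψ (≤-trans T≤U U≤V) = ≤-trans (≤-⟦⟧ ψ T≤U) (≤-⟦⟧ ψ U≤V)

      module _ (boxTypesNoSizeVar : ∀ f → sortOf f ≡ □ → NoSizeVar (typeOf f)) where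

        ⊢-⟦⟧ : ∀ {Γ t T} → Γ ⊢ t ∶ T → ∀ ψ → Γ ⟦ ψ ⟧ᶜ ⊢ t ⟦ ψ ⟧ ∶ T ⟦ ψ ⟧
        ⊢-⟦⟧ ax ψ = ax
        ⊢-⟦⟧ (size {C} {a} cf ⊢τ) ψ =
          ≡.subst ([] ⊢ csym C (a ⟪ ψ ⟫) ∶_)
                  (sym (⟦⟧-noSizeVar (typeOf C) ψ (boxTypesNoSizeVar C (proj₁ cf))))
                  (size cf ⊢τ)
        ⊢-⟦⟧ (symb {f} ¬cf ⊢τ φ) ψ =
          ≡.subst ([] ⊢ fsym f ∶_) (sym (⟦⟧-⨾ (typeOf f) φ ψ)) (symb ¬cf ⊢τ (φ ⨾ ψ))
        ⊢-⟦⟧ (varI {Γ} {T} {s} ⊢T) ψ =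
          ≡.subst ((s , T ⟦ ψ ⟧) ∷ Γ ⟦ ψ ⟧ᶜ ⊢ var zero ∶_) (sym (rename-⟦⟧ suc T ψ)) (varI (⊢-⟦⟧ ⊢T ψ))
        ⊢-⟦⟧ (weak {t = t} {T} ⊢t ⊢U) ψ =
          subst₂ (_ ⊢_∶_) (sym (rename-⟦⟧ suc t ψ)) (sym (rename-⟦⟧ suc T ψ))
                 (weak (⊢-⟦⟧ ⊢t ψ) (⊢-⟦⟧ ⊢U ψ))
        ⊢-⟦⟧ (prod ⊢U ⊢V) ψ = prod (⊢-⟦⟧ ⊢U ψ) (⊢-⟦⟧ ⊢V ψ)
        ⊢-⟦⟧ (abs ⊢v ⊢Π) ψ = abs (⊢-⟦⟧ ⊢v ψ) (⊢-⟦⟧ ⊢Π ψ)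
        ⊢-⟦⟧ (appI {u = u} {V = V} ⊢t ⊢u) ψ =
          ≡.subst (_ ⊢ _ ∶_) (sym ([]-⟦⟧ V u ψ)) (appI (⊢-⟦⟧ ⊢t ψ) (⊢-⟦⟧ ⊢u ψ))
        ⊢-⟦⟧ (sub ⊢t ⊢T' T≤T') ψ = sub (⊢-⟦⟧ ⊢t ψ) (⊢-⟦⟧ ⊢T' ψ) (≤-⟦⟧ ψ T≤T')

mainTheorem7 : (SSym : Set) (ar : SSym → ℕ) (Sym : Set)
               (_≤A_ : Sizes.Size SSym ar → Sizes.Size SSym ar → Set)
               (sortOf : Sym → Sort)
               (typeOf : Sym → Syntax.Term SSym ar Sym)
               (Rule : Syntax.Term SSym ar Sym → Syntax.Term SSym ar Sym → Set) →
               let open CAC SSym ar Sym _≤A_ sortOf typeOf Rule in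
               SizeOrderAssumption → SymbolTypeAssumption → RuleAssumption →
               WellTypedSymbols → Confluent → RulesPreserveTyping →
               ∀ {Γ t T} → Γ ⊢ t ∶ T →
               (ψ : SizeSubst) → (Γ ⟦ ψ ⟧ᶜ) ⊢ t ⟦ ψ ⟧ ∶ T ⟦ ψ ⟧
mainTheorem7 SSym ar Sym _≤A_ sortOf typeOf Rule
             (_ , _ , ≤A-⟪⟫) (_ , boxTypesNoSizeVar) rulesNoSizeVar _ _ _ =
  ⊢-⟦⟧ rulesNoSizeVar ≤A-⟪⟫ boxTypesNoSizeVar
  where open SizeSubstitutionStability SSym ar Sym _≤A_ sortOf typeOf Rule
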